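{- In an empty-ply drawing of a graph, for any two edges $(u,v)$ and $(v,w)$ incident to the same vertex $v$, we have $\frac12 \le \frac{|uv|}{|vw|} \le 2$, where $|xy|$ denotes the Euclidean length of the segment between $x$ and $y$ in the drawing.
   Context: A straight-line drawing of a graph places each vertex at a distinct point of the plane and draws each edge as the straight-line segment between its endpoints. For each vertex $v$, the ply-disk $D_v$ is the open disk centered at $v$ with radius equal to half the length of the longest edge incident to $v$. A drawing is empty-ply if every ply-disk $D_v$ contains no vertex other than $v$ in its interior. -}

module Defs where

open import Level using (Level; _⊔_) renaming (suc to lsuc)
open import Algebra.Bundles using (CommutativeRing)
open import Relation.Binary.Core using (Rel)
open import Relation.Binary.Structures using (IsStrictTotalOrder)
open import Data.Nat using (ℕ)
open import Data.Fin using (Fin)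
open import Data.Product using (_×_; _,_; Σ; proj₁; proj₂)
open import Data.Sum using (_⊎_)
open import Relation.Nullary using (¬_)
open import Relation.Binary.PropositionalEquality using (_≡_)

-- The agda-stdlib
-- has no real numbers, so the Euclidean plane is taken as K × K for an
-- arbitrary ordered commutative ring K; ℝ is one instance.
record OrderedCommRing (c ℓ₁ ℓ₂ : Level) : Set (lsuc (c ⊔ ℓ₁ ⊔ ℓ₂)) where
  field
    commRing : CommutativeRing c ℓ₁
  open CommutativeRing commRing public
  infix 4 _<_
  field
    _<_                : Rel Carrier ℓ₂
    isStrictTotalOrder : IsStrictTotalOrder _≈_ _<_
    +-mono-<           : ∀ {x y} z → x < y → x + z < y + z
    *-pos              : ∀ {x y} → 0# < x → 0# < y → 0# < x * y

  infix 4 _≤_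
  _≤_ : Rel Carrier (ℓ₁ ⊔ ℓ₂)
  x ≤ y = (x < y) ⊎ (x ≈ y)

  four : Carrier
  four = 1# + 1# + 1# + 1#

  Point : Set c
  Point = Carrier × Carrier

  _≈ₚ_ : Point → Point → Set ℓ₁
  p ≈ₚ q = (proj₁ p ≈ proj₁ q) × (proj₂ p ≈ proj₂ q)

  sqDist : Point → Point → Carrier
  sqDist p q = let dx = proj₁ p - proj₁ q ; dy = proj₂ p - proj₂ q
               in dx * dx + dy * dy

record Graph (n : ℕ) : Set₁ where
  field
    Adj     : Fin n → Fin n → Set
    sym     : ∀ {u v} → Adj u v → Adj v u
    irrefl  : ∀ {v} → ¬ Adj v v

module _ {c ℓ₁ ℓ₂} (K : OrderedCommRing c ℓ₁ ℓ₂) where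
  open OrderedCommRing K

  -- A straight-line drawing: distinct vertices at distinct points
  -- (edges are the segments between endpoints; only the positions matter).
  record Drawing {n : ℕ} (G : Graph n) : Set (c ⊔ ℓ₁) where
    field
      pos      : Fin n → Point
      distinct : ∀ {i j} → ¬ (i ≡ j) → ¬ (pos i ≈ₚ pos j)

  -- A point p lies in the interior of the ply-disk D_v, i.e.
  --   |v p| < (max_{x adjacent to v} |v x|) / 2 .
  -- Since the maximum is attained by some neighbour x, and lengths are
  -- non-negative, this is:  ∃ x adjacent to v with 4·|vp|² < |vx|².
  -- (If v is isolated, D_v is empty.)
  InPlyDisk : {n : ℕ} {G : Graph n} → Drawing G → Fin n → Point → Set (ℓ₂)
  InPlyDisk {G = G} Γ v p =
    Σ (Fin _) λ x → Graph.Adj G v x × (four * sqDist (Drawing.pos Γ v) p < sqDist (Drawing.pos Γ v) (Drawing.pos Γ x))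

  EmptyPly : {n : ℕ} {G : Graph n} → Drawing G → Set ℓ₂
  EmptyPly {n} Γ = ∀ (v w : Fin n) → ¬ (v ≡ w) → ¬ InPlyDisk Γ v (Drawing.pos Γ w)

-- The ply-disk of v has radius at least |vw|/2 for every neighbour w of v,
-- and it may not contain the neighbour u; hence |uv| ≥ |vw|/2.  Exchanging
-- the roles of u and w gives the other bound.

module Submission where

open import Defs
open import Data.Nat using (ℕ)
open import Data.Fin using (Fin)
open import Data.Product using (_×_; _,_)
open import Data.Sum using (inj₁; inj₂)
open import Relation.Nullary using (¬_; contradiction)
open import Relation.Binary.Definitions using (tri<; tri≈; tri>)
open import Relation.Binary.Structures using (IsStrictTotalOrder)
open import Relation.Binary.PropositionalEquality using (_≡_; subst) renaming (sym to ≡-sym)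
import Relation.Binary.Construct.StrictToNonStrict as StrictToNonStrict
import Relation.Binary.Reasoning.Setoid as SetoidReasoning
import Algebra.Properties.Ring as RingProperties
import Algebra.Properties.AbelianGroup as AbelianGroupProperties

module OrderedCommRingProperties {c ℓ₁ ℓ₂} (K : OrderedCommRing c ℓ₁ ℓ₂) where
  open OrderedCommRing K
  open IsStrictTotalOrder isStrictTotalOrder using (compare; <-respˡ-≈; <-respʳ-≈)
  open RingProperties ring using (-‿distribˡ-*; -‿distribʳ-*; -‿involutive)
  open AbelianGroupProperties +-abelianGroup using (⁻¹-anti-homo‿-)
  open SetoidReasoning setoid

  ≮⇒≥ : ∀ {x y} → ¬ (x < y) → y ≤ x
  ≮⇒≥ {x} {y} x≮y with compare x y
  ... | tri< x<y _ _ = contradiction x<y x≮y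
  ... | tri≈ _ x≈y _ = inj₂ (sym x≈y)
  ... | tri> _ _ y<x = inj₁ y<x

  ≤-respʳ-≈ : ∀ {x y z} → y ≈ z → x ≤ y → x ≤ z
  ≤-respʳ-≈ = StrictToNonStrict.≤-respʳ-≈ _≈_ _<_ trans <-respʳ-≈

  ≤-respˡ-≈ : ∀ {x y z} → x ≈ y → x ≤ z → y ≤ z
  ≤-respˡ-≈ = StrictToNonStrict.≤-respˡ-≈ _≈_ _<_ sym trans <-respˡ-≈

  -x*-x≈x*x : ∀ x → - x * - x ≈ x * x
  -x*-x≈x*x x = begin
    - x * - x      ≈⟨ -‿distribˡ-* x (- x) ⟨
    - (x * - x)    ≈⟨ -‿cong (-‿distribʳ-* x x) ⟨
    - - (x * x)    ≈⟨ -‿involutive (x * x) ⟩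
    x * x          ∎

  [x-y]²≈[y-x]² : ∀ x y → (x - y) * (x - y) ≈ (y - x) * (y - x)
  [x-y]²≈[y-x]² x y = begin
    (x - y) * (x - y)          ≈⟨ -x*-x≈x*x (x - y) ⟨
    - (x - y) * - (x - y)      ≈⟨ *-cong (⁻¹-anti-homo‿- x y) (⁻¹-anti-homo‿- x y) ⟩
    (y - x) * (y - x)          ∎

  sqDist-sym : ∀ p q → sqDist p q ≈ sqDist q p
  sqDist-sym (x₁ , y₁) (x₂ , y₂) = +-cong ([x-y]²≈[y-x]² x₁ x₂) ([x-y]²≈[y-x]² y₁ y₂)

Adj⇒≢ : ∀ {n} (G : Graph n) {u v : Fin n} → Graph.Adj G u v → ¬ (u ≡ v)
Adj⇒≢ G {u} adj u≡v = Graph.irrefl G (subst (Graph.Adj G u) (≡-sym u≡v) adj)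

module _ {c ℓ₁ ℓ₂} (K : OrderedCommRing c ℓ₁ ℓ₂) {n : ℕ} {G : Graph n}
         (Γ : Drawing K G) (emptyPly : EmptyPly K Γ) where
  open OrderedCommRing K
  private p = Drawing.pos Γ

  EmptyPly⇒edge-ratio : ∀ {u v w : Fin n} → Graph.Adj G v u → Graph.Adj G v w →
                        sqDist (p v) (p w) ≤ four * sqDist (p v) (p u)
  EmptyPly⇒edge-ratio {u} {v} {w} vu vw = OrderedCommRingProperties.≮⇒≥ K
    λ u∈Dᵥ → emptyPly v u (Adj⇒≢ G vu) (w , vw , u∈Dᵥ)

lemma2 : ∀ {c ℓ₁ ℓ₂} (K : OrderedCommRing c ℓ₁ ℓ₂) {n : ℕ} (G : Graph n)
           (Γ : Drawing K G) → EmptyPly K Γ →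
           ∀ (u v w : Fin n) → Graph.Adj G u v → Graph.Adj G v w →
           let open OrderedCommRing K
               p = Drawing.pos Γ
           in (sqDist (p v) (p w) ≤ four * sqDist (p u) (p v))
              × (sqDist (p u) (p v) ≤ four * sqDist (p v) (p w))
lemma2 K G Γ emptyPly u v w uv vw =
    ≤-respʳ-≈ (*-congˡ (sqDist-sym (p v) (p u))) (EmptyPly⇒edge-ratio K Γ emptyPly vu vw)
  , ≤-respˡ-≈ (sqDist-sym (p v) (p u)) (EmptyPly⇒edge-ratio K Γ emptyPly vw vu)
  where
  open OrderedCommRing K
  open OrderedCommRingProperties K
  p = Drawing.pos Γ
  vu = Graph.sym G uv
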